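{- Let $k\ge 1$, $d\ge k$, $\nu>d$ be integers and $(Y,X)$ a base of $LP_{\nu,d,k}$. Then the basic solution associated with $(Y,X)$ has all non-basic variables equal to $0$ and basic variables $$y_i=-\prod_{a\in(Y\cup X)\setminus\{i\}}\frac{\nu-a}{i-a}\Big/\binom{\nu}{i}\quad (i\in Y),\qquad x_i=\prod_{a\in(Y\cup X)\setminus\{i\}}\frac{\nu-a}{i-a}\Big/\binom{\nu}{i}\quad (i\in X).$$
   Context: Binomial coefficients $\binom{n}{m}$ are $0$ when $m<0$ or $m>n$. $LP_{\nu,d,k}$ is the linear program in real variables $y_0,\ldots,y_{\nu-1},x_0,\ldots,x_d\ge 0$: minimize $\sum_{i=0}^{\nu-1}\binom{\nu}{i}y_i+\sum_{i=0}^d\binom{\nu}{i}x_i$ subject to $(c_k)$: $\sum_{i=k}^d\binom{\nu-k}{i-k}x_i-\sum_{i=k}^{\nu-1}\binom{\nu-k}{i-k}y_i=1$, and $(c_h)$ for $h\in\{0,\ldots,k-1\}$: $\sum_{i=h}^d\binom{\nu-k}{i-h}x_i-\sum_{i=h}^{\nu-k+h}\binom{\nu-k}{i-h}y_i=0$. A pair $(Y,X)$ with $Y\subseteq\{0,\ldots,\nu-1\}$, $X\subseteq\{0,\ldots,d\}$ is a base if the variables $\{y_i:i\in Y\}\cup\{x_i:i\in X\}$ form a linear-programming basis (their constraint-matrix columns form a basis of $\mathbb{R}^{k+1}$). The associated basic solution is the unique solution of the equality constraints in which all variables outside the base are $0$.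
   Formalization: The variables $y_i$, $x_i$ of $LP_{\nu,d,k}$ are rational rather than real, and a base is a family of columns forming a basis of ℚ^(k+1). -}

module Defs where

open import Data.Nat as ℕ using (ℕ; zero; suc; _∸_; _<_; _≤_; _≡ᵇ_)
open import Data.Nat.Combinatorics using (_C_)
open import Data.Integer as ℤ using (ℤ; +_; -[1+_])
open import Data.Rational using (ℚ; _/_; 0ℚ; 1ℚ; _+_; _*_; _-_; _÷_; ≢-nonZero)
open import Data.Rational.Properties using (_≟_)
open import Data.Bool using (Bool; _∧_; _∨_; not)
open import Data.List using (List; filterᵇ; upTo; foldr)
open import Data.List.Membership.Propositional using (_∈_; _∉_)
open import Data.List.Membership.DecPropositional ℕ._≟_ using (_∈?_)
open import Data.List.Relation.Unary.All using (All)
open import Data.Product using (_×_; ∃₂)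
open import Relation.Binary.PropositionalEquality using (_≡_)
open import Relation.Nullary using (yes; no)
open import Relation.Nullary.Decidable using (⌊_⌋)

ℕ→ℚ : ℕ → ℚ
ℕ→ℚ n = + n / 1

ℤ→ℚ : ℤ → ℚ
ℤ→ℚ z = z / 1

-- binomial coefficient (n choose m) for integer m, equal to 0 when m < 0
-- (stdlib's  n C m  is already 0 when m > n)
binZ : ℕ → ℤ → ℚ
binZ n (+ m)    = ℕ→ℚ (n C m)
binZ n -[1+ m ] = 0ℚ

-- Σ_{i = lo}^{hi} f i  (empty when hi < lo)
sumRange : ℕ → ℕ → (ℕ → ℚ) → ℚ
sumRange lo hi f = go (suc hi ∸ lo)
  where
  go : ℕ → ℚ
  go zero    = 0ℚ
  go (suc n) = go n + f (lo ℕ.+ n)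

-- totalised division on ℚ (p / 0 := 0); only ever applied to nonzero divisors
divℚ : ℚ → ℚ → ℚ
divℚ p q with q ≟ 0ℚ
... | yes _   = 0ℚ
... | no q≢0 = _÷_ p q {{≢-nonZero q≢0}}

-- upper summation limit of the y-part of constraint (c_h):
--   ν-1 for h = k, and ν-k+h for h < k
yUpper : (ν k h : ℕ) → ℕ
yUpper ν k h with h ℕ.≟ k
... | yes _ = ν ∸ 1
... | no  _ = ν ∸ k ℕ.+ h

-- left-hand side of constraint (c_h) of LP_{ν,d,k}, for variables y x : ℕ → ℚ
-- (y i is y_i for i < ν, x i is x_i for i ≤ d; other values are never read)
lhs : (ν d k h : ℕ) → (y x : ℕ → ℚ) → ℚ
lhs ν d k h y x =
  sumRange h d (λ i → binZ (ν ∸ k) (+ i ℤ.- + h) * x i)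
  - sumRange h (yUpper ν k h) (λ i → binZ (ν ∸ k) (+ i ℤ.- + h) * y i)

Supported : (Y X : List ℕ) → (y x : ℕ → ℚ) → Set
Supported Y X y x = (∀ i → i ∉ Y → y i ≡ 0ℚ) × (∀ i → i ∉ X → x i ≡ 0ℚ)

-- (Y , X) is a base of LP_{ν,d,k}: Y ⊆ {0..ν-1}, X ⊆ {0..d}, and the columns
-- {col y_i : i ∈ Y} ∪ {col x_i : i ∈ X} form a basis of ℚ^{k+1}
-- (rows indexed by h = 0..k), i.e. they are linearly independent and spanning.
IsBase : (ν d k : ℕ) → (Y X : List ℕ) → Set
IsBase ν d k Y X =
  All (_< ν) Y × All (_≤ d) X
  × (∀ (y x : ℕ → ℚ) → Supported Y X y x
       → (∀ h → h ≤ k → lhs ν d k h y x ≡ 0ℚ)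
       → (∀ i → i ∈ Y → y i ≡ 0ℚ) × (∀ i → i ∈ X → x i ≡ 0ℚ))
  × (∀ (b : ℕ → ℚ) → ∃₂ λ (y x : ℕ → ℚ) → Supported Y X y x
       × (∀ h → h ≤ k → lhs ν d k h y x ≡ b h))

IsBasicSolution : (ν d k : ℕ) → (Y X : List ℕ) → (y x : ℕ → ℚ) → Set
IsBasicSolution ν d k Y X y x =
  Supported Y X y x
  × lhs ν d k k y x ≡ 1ℚ
  × (∀ h → h < k → lhs ν d k h y x ≡ 0ℚ)

-- (Y ∪ X) \ {i}, listed in increasing order (Y, X ⊆ {0..ν-1})
others : (ν : ℕ) → (Y X : List ℕ) → ℕ → List ℕ
others ν Y X i =
  filterᵇ (λ a → (⌊ a ∈? Y ⌋ ∨ ⌊ a ∈? X ⌋) ∧ not (a ≡ᵇ i)) (upTo ν)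

coef : (ν : ℕ) → (Y X : List ℕ) → ℕ → ℚ
coef ν Y X i =
  divℚ (foldr (λ a acc → divℚ (ℤ→ℚ (+ ν ℤ.- + a)) (ℤ→ℚ (+ i ℤ.- + a)) * acc)
              1ℚ (others ν Y X i))
       (ℕ→ℚ (ν C i))

{-# OPTIONS --safe #-}
module Submission where

-- The constraints read Σ_i binom(ν-k, i-h) (x_i - y_i) = [h = k] for h = 0, …, k.
-- Fix j in the base and let P(t) = ∏ (t - a) over the other base indices a. The
-- base columns are independent, so by Gaussian elimination there are at most k such
-- a; hence i ↦ binom(ν, i) P(i), a binomial coefficient times a polynomial of degree
-- at most k, is a combination Σ_h α_h binom(ν-k, i-h) of the constraint rows, and
-- evaluating at i = ν gives α_k = P(ν). Pairing this combination with the basic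
-- solution, which vanishes off the base while P vanishes on the base away from j,
-- yields (x_j - y_j) binom(ν, j) P(j) = Σ_h α_h [h = k] = P(ν). As Y and X are
-- disjoint, this is the claimed formula.

open import Defs
open import Data.Nat as ℕ using (ℕ; zero; suc; _≤_; _<_; _≤′_; _∸_; z≤n; s≤s; s<s; z<s; ≤′-refl; ≤′-step)
open import Data.Nat.Properties as ℕ
  using (m<n⇒m<1+n; n<1+n; ≤-pred; ≤∧≢⇒<; ≤-<-trans; <-≤-trans; <⇒≤; <⇒≱; ≰⇒>; ≤⇒≤′; ≤′⇒≤;
         +-suc; m+[n∸m]≡n)
open import Data.Nat.Combinatorics using (_C_; k>n⇒nCk≡0; nCn≡1; nC1≡n; nCk+nC[k+1]≡[n+1]C[k+1])
import Data.Nat.Tactic.RingSolver as ℕ-Solver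
open import Data.Integer as ℤ using (ℤ; +_)
import Data.Integer.Properties as ℤ
import Data.Integer.Tactic.RingSolver as ℤ-Solver
open import Data.Rational using (ℚ; -_; _+_; _*_; _-_; 0ℚ; 1ℚ; 1/_; ≢-nonZero; toℚᵘ)
open import Data.Rational.Properties
  using (_≟_; 1≢0; toℚᵘ-injective; toℚᵘ-cong; toℚᵘ-fromℚᵘ; toℚᵘ-homo-+; toℚᵘ-homo-*; toℚᵘ-homo‿-;
         +-identityˡ; +-identityʳ; +-inverseʳ; +-comm; *-identityˡ; *-identityʳ; *-zeroˡ; *-zeroʳ; *-assoc; *-comm;
         *-distribˡ-+; *-distribʳ-+; *-inverseʳ; neg-distrib-+;
         +-0-group; +-0-commutativeMonoid; *-1-commutativeMonoid; +-*-ring)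
open import Data.Rational.Unnormalised as ℚᵘ using (mkℚᵘ; *≡*)
import Data.Rational.Unnormalised.Properties as ℚᵘ
open import Data.Rational.Solver using (module +-*-Solver)
open import Algebra.Properties.Group +-0-group using (x∙y⁻¹≈ε⇒x≈y) renaming (⁻¹-involutive to neg-involutive)
open import Algebra.Properties.Ring +-*-ring using (x[y-z]≈xy-xz)
open import Algebra.Bundles using (CommutativeMonoid)
open import Algebra.Properties.CommutativeSemigroup (CommutativeMonoid.commutativeSemigroup +-0-commutativeMonoid)
  using () renaming (interchange to +-interchange)
open import Algebra.Properties.CommutativeSemigroup (CommutativeMonoid.commutativeSemigroup *-1-commutativeMonoid)
  using (x∙yz≈y∙xz) renaming (interchange to *-interchange)
open import Data.Bool using (Bool; T; _∧_; _∨_; not)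
open import Data.Bool.Properties using (T-∧; T-∨; T-not-≡; ¬-not)
open import Data.List using (List; []; _∷_; length; upTo; foldr; filter)
open import Data.List.Properties using (length-upTo; filter-notAll)
open import Data.List.Membership.Propositional using (_∈_; _∉_; find)
open import Data.List.Membership.DecPropositional ℕ._≟_ using (_∈?_)
open import Data.List.Membership.Propositional.Properties using (∈-filter⁺; ∈-filter⁻; ∈-upTo⁺; ∈-upTo⁻)
open import Data.List.Relation.Unary.Any as Any using (here; there)
open import Data.List.Relation.Unary.All as All using (All; []; _∷_; all?)
open import Data.List.Relation.Unary.All.Properties using (¬All⇒Any¬)
open import Data.List.Relation.Unary.AllPairs using (_∷_)
open import Data.List.Relation.Unary.Unique.Propositional using (Unique)
import Data.List.Relation.Unary.Unique.Propositional.Properties as Unique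
open import Data.Product using (_×_; _,_; proj₁; proj₂)
open import Data.Sum as Sum using (_⊎_; inj₁; inj₂; [_,_])
open import Data.Empty using (⊥; ⊥-elim)
open import Function using (_∘_; Equivalence)
open import Relation.Nullary using (yes; no; ¬?)
open import Relation.Nullary.Decidable using (⌊_⌋; T?; toWitness; fromWitness)
open import Relation.Binary.PropositionalEquality
  using (_≡_; _≢_; refl; sym; trans; cong; cong₂; subst; module ≡-Reasoning)

open +-*-Solver using (solve; _:+_; _:*_; _:-_; :-_; _:=_; con)

-- Embedding ℕ and ℤ into ℚ

toℚᵘ-ℤ→ℚ : ∀ z → toℚᵘ (ℤ→ℚ z) ℚᵘ.≃ mkℚᵘ z 0
toℚᵘ-ℤ→ℚ z = toℚᵘ-fromℚᵘ (mkℚᵘ z 0)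

ℤ→ℚ-+ : ∀ p q → ℤ→ℚ (p ℤ.+ q) ≡ ℤ→ℚ p + ℤ→ℚ q
ℤ→ℚ-+ p q = toℚᵘ-injective (begin
  toℚᵘ (ℤ→ℚ (p ℤ.+ q))              ≈⟨ toℚᵘ-ℤ→ℚ (p ℤ.+ q) ⟩
  mkℚᵘ (p ℤ.+ q) 0                   ≈⟨ *≡* (sum-eq p q) ⟩
  mkℚᵘ p 0 ℚᵘ.+ mkℚᵘ q 0             ≈⟨ ℚᵘ.+-cong (toℚᵘ-ℤ→ℚ p) (toℚᵘ-ℤ→ℚ q) ⟨
  toℚᵘ (ℤ→ℚ p) ℚᵘ.+ toℚᵘ (ℤ→ℚ q)     ≈⟨ toℚᵘ-homo-+ (ℤ→ℚ p) (ℤ→ℚ q) ⟨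
  toℚᵘ (ℤ→ℚ p + ℤ→ℚ q)              ∎)
  where
  open ℚᵘ.≃-Reasoning
  sum-eq : ∀ p q → (p ℤ.+ q) ℤ.* (+ 1 ℤ.* + 1) ≡ (p ℤ.* + 1 ℤ.+ q ℤ.* + 1) ℤ.* + 1
  sum-eq = ℤ-Solver.solve-∀

ℤ→ℚ-neg : ∀ p → ℤ→ℚ (ℤ.- p) ≡ - ℤ→ℚ p
ℤ→ℚ-neg p = toℚᵘ-injective (begin
  toℚᵘ (ℤ→ℚ (ℤ.- p))       ≈⟨ toℚᵘ-ℤ→ℚ (ℤ.- p) ⟩
  mkℚᵘ (ℤ.- p) 0           ≈⟨ *≡* refl ⟩
  ℚᵘ.- mkℚᵘ p 0            ≈⟨ ℚᵘ.-‿cong (toℚᵘ-ℤ→ℚ p) ⟨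
  ℚᵘ.- toℚᵘ (ℤ→ℚ p)        ≈⟨ toℚᵘ-homo‿- (ℤ→ℚ p) ⟨
  toℚᵘ (- ℤ→ℚ p)           ∎)
  where open ℚᵘ.≃-Reasoning

ℤ→ℚ-* : ∀ p q → ℤ→ℚ (p ℤ.* q) ≡ ℤ→ℚ p * ℤ→ℚ q
ℤ→ℚ-* p q = toℚᵘ-injective (begin
  toℚᵘ (ℤ→ℚ (p ℤ.* q))              ≈⟨ toℚᵘ-ℤ→ℚ (p ℤ.* q) ⟩
  mkℚᵘ (p ℤ.* q) 0                   ≈⟨ *≡* refl ⟩
  mkℚᵘ p 0 ℚᵘ.* mkℚᵘ q 0             ≈⟨ ℚᵘ.*-cong (toℚᵘ-ℤ→ℚ p) (toℚᵘ-ℤ→ℚ q) ⟨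
  toℚᵘ (ℤ→ℚ p) ℚᵘ.* toℚᵘ (ℤ→ℚ q)     ≈⟨ toℚᵘ-homo-* (ℤ→ℚ p) (ℤ→ℚ q) ⟨
  toℚᵘ (ℤ→ℚ p * ℤ→ℚ q)              ∎)
  where open ℚᵘ.≃-Reasoning

ℤ→ℚ-injective : ∀ {p q} → ℤ→ℚ p ≡ ℤ→ℚ q → p ≡ q
ℤ→ℚ-injective {p} {q} eq
  with *≡* p*1≡q*1 ← ℚᵘ.≃-trans (ℚᵘ.≃-sym (toℚᵘ-ℤ→ℚ p)) (ℚᵘ.≃-trans (toℚᵘ-cong eq) (toℚᵘ-ℤ→ℚ q)) =
  trans (sym (ℤ.*-identityʳ p)) (trans p*1≡q*1 (ℤ.*-identityʳ q))

ℤ→ℚ-minus : ∀ p q → ℤ→ℚ (p ℤ.- q) ≡ ℤ→ℚ p - ℤ→ℚ q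
ℤ→ℚ-minus p q = trans (ℤ→ℚ-+ p (ℤ.- q)) (cong (_+_ (ℤ→ℚ p)) (ℤ→ℚ-neg q))

ℕ→ℚ-+ : ∀ m n → ℕ→ℚ (m ℕ.+ n) ≡ ℕ→ℚ m + ℕ→ℚ n
ℕ→ℚ-+ m n = ℤ→ℚ-+ (+ m) (+ n)

ℕ→ℚ-* : ∀ m n → ℕ→ℚ (m ℕ.* n) ≡ ℕ→ℚ m * ℕ→ℚ n
ℕ→ℚ-* m n = trans (cong ℤ→ℚ (ℤ.pos-* m n)) (ℤ→ℚ-* (+ m) (+ n))

ℕ→ℚ-injective : ∀ {m n} → ℕ→ℚ m ≡ ℕ→ℚ n → m ≡ n
ℕ→ℚ-injective = ℤ.+-injective ∘ ℤ→ℚ-injective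

[1+m]-[1+n]≡m-n : ∀ m n → + suc m ℤ.- + suc n ≡ + m ℤ.- + n
[1+m]-[1+n]≡m-n m n = trans (ℤ.[1+m]⊖[1+n]≡m⊖n m n) (sym (ℤ.m-n≡m⊖n m n))

ℕ→ℚ-suc-minus-suc : ∀ m n → ℕ→ℚ (suc m) - ℕ→ℚ (suc n) ≡ ℕ→ℚ m - ℕ→ℚ n
ℕ→ℚ-suc-minus-suc m n = begin
  ℕ→ℚ (suc m) - ℕ→ℚ (suc n)     ≡⟨ ℤ→ℚ-minus (+ suc m) (+ suc n) ⟨
  ℤ→ℚ (+ suc m ℤ.- + suc n)     ≡⟨ cong ℤ→ℚ ([1+m]-[1+n]≡m-n m n) ⟩
  ℤ→ℚ (+ m ℤ.- + n)             ≡⟨ ℤ→ℚ-minus (+ m) (+ n) ⟩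
  ℕ→ℚ m - ℕ→ℚ n                 ∎
  where open ≡-Reasoning

ℕ→ℚ-minus-≢0 : ∀ {m n} → m ≢ n → ℕ→ℚ m - ℕ→ℚ n ≢ 0ℚ
ℕ→ℚ-minus-≢0 m≢n eq = m≢n (ℕ→ℚ-injective (x∙y⁻¹≈ε⇒x≈y _ _ eq))

*-cancelʳ-≡ : ∀ a b c → c ≢ 0ℚ → a * c ≡ b * c → a ≡ b
*-cancelʳ-≡ a b c c≢0 eq = begin
  a                ≡⟨ undo a ⟨
  a * c * c⁻¹      ≡⟨ cong (_* c⁻¹) eq ⟩
  b * c * c⁻¹      ≡⟨ undo b ⟩
  b                ∎
  where
  open ≡-Reasoning
  instance _ = ≢-nonZero c≢0
  c⁻¹ = 1/ c
  undo : ∀ x → x * c * c⁻¹ ≡ x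
  undo x = trans (*-assoc x c c⁻¹) (trans (cong (x *_) (*-inverseʳ c)) (*-identityʳ x))

*-≢0 : ∀ {p q} → p ≢ 0ℚ → q ≢ 0ℚ → p * q ≢ 0ℚ
*-≢0 {p} {q} p≢0 q≢0 pq≡0 = p≢0 (*-cancelʳ-≡ p 0ℚ q q≢0 (trans pq≡0 (sym (*-zeroˡ q))))

divℚ[p,q]*q≡p : ∀ p q → q ≢ 0ℚ → divℚ p q * q ≡ p
divℚ[p,q]*q≡p p q q≢0 with q ≟ 0ℚ
... | yes q≡0 = ⊥-elim (q≢0 q≡0)
... | no  q≢0 = begin
  p * 1/ q * q      ≡⟨ *-assoc p (1/ q) q ⟩
  p * (1/ q * q)    ≡⟨ cong (p *_) (trans (*-comm (1/ q) q) (*-inverseʳ q)) ⟩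
  p * 1ℚ            ≡⟨ *-identityʳ p ⟩
  p                 ∎
  where
  open ≡-Reasoning
  instance _ = ≢-nonZero q≢0

-- Finite sums

∑ : ℕ → (ℕ → ℚ) → ℚ
∑ zero    f = 0ℚ
∑ (suc n) f = ∑ n f + f n

∑-cong : ∀ n {f g : ℕ → ℚ} → (∀ i → i < n → f i ≡ g i) → ∑ n f ≡ ∑ n g
∑-cong zero    f≗g = refl
∑-cong (suc n) f≗g = cong₂ _+_ (∑-cong n (λ i i<n → f≗g i (m<n⇒m<1+n i<n))) (f≗g n (n<1+n n))

∑≡0 : ∀ n {f : ℕ → ℚ} → (∀ i → i < n → f i ≡ 0ℚ) → ∑ n f ≡ 0ℚ
∑≡0 zero    f≡0 = refl
∑≡0 (suc n) f≡0 = cong₂ _+_ (∑≡0 n (λ i i<n → f≡0 i (m<n⇒m<1+n i<n))) (f≡0 n (n<1+n n))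

∑-+ : ∀ n (f g : ℕ → ℚ) → ∑ n (λ i → f i + g i) ≡ ∑ n f + ∑ n g
∑-+ zero    f g = refl
∑-+ (suc n) f g = trans (cong (_+ (f n + g n)) (∑-+ n f g)) (+-interchange (∑ n f) (∑ n g) (f n) (g n))

∑-neg : ∀ n (f : ℕ → ℚ) → ∑ n (λ i → - f i) ≡ - ∑ n f
∑-neg zero    f = refl
∑-neg (suc n) f = trans (cong (_+ - f n) (∑-neg n f)) (sym (neg-distrib-+ (∑ n f) (f n)))

∑-minus : ∀ n (f g : ℕ → ℚ) → ∑ n (λ i → f i - g i) ≡ ∑ n f - ∑ n g
∑-minus n f g = trans (∑-+ n f (λ i → - g i)) (cong (_+_ (∑ n f)) (∑-neg n g))

*-distribˡ-∑ : ∀ n c (f : ℕ → ℚ) → c * ∑ n f ≡ ∑ n (λ i → c * f i)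
*-distribˡ-∑ zero    c f = *-zeroʳ c
*-distribˡ-∑ (suc n) c f = trans (*-distribˡ-+ c (∑ n f) (f n)) (cong (_+ c * f n) (*-distribˡ-∑ n c f))

∑-swap : ∀ n m (F : ℕ → ℕ → ℚ) → ∑ n (λ i → ∑ m (F i)) ≡ ∑ m (λ h → ∑ n (λ i → F i h))
∑-swap zero    m F = sym (∑≡0 m (λ _ _ → refl))
∑-swap (suc n) m F = trans (cong (_+ ∑ m (F n)) (∑-swap n m F)) (sym (∑-+ m (λ h → ∑ n (λ i → F i h)) (F n)))

∑-single : ∀ n {f : ℕ → ℚ} j → j < n → (∀ i → i < n → i ≢ j → f i ≡ 0ℚ) → ∑ n f ≡ f j
∑-single (suc n) {f} j j<1+n off with j ℕ.≟ n
... | yes refl = begin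
  ∑ j f + f j    ≡⟨ cong (_+ f j) (∑≡0 j (λ i i<j → off i (m<n⇒m<1+n i<j) (λ { refl → ℕ.<-irrefl refl i<j }))) ⟩
  0ℚ + f j       ≡⟨ +-identityˡ (f j) ⟩
  f j            ∎
  where open ≡-Reasoning
... | no j≢n = begin
  ∑ n f + f n    ≡⟨ cong₂ _+_ (∑-single n j j<n (λ i i<n → off i (m<n⇒m<1+n i<n))) (off n (n<1+n n) (j≢n ∘ sym)) ⟩
  f j + 0ℚ       ≡⟨ +-identityʳ (f j) ⟩
  f j            ∎
  where
  open ≡-Reasoning
  j<n = ≤∧≢⇒< (≤-pred j<1+n) j≢n

∑-extend : ∀ {n m} {f : ℕ → ℚ} → n ≤′ m → (∀ i → n ≤ i → i < m → f i ≡ 0ℚ) → ∑ n f ≡ ∑ m f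
∑-extend ≤′-refl _ = refl
∑-extend {n} {suc m} {f} (≤′-step n≤′m) vanish = begin
  ∑ n f          ≡⟨ ∑-extend n≤′m (λ i n≤i i<m → vanish i n≤i (m<n⇒m<1+n i<m)) ⟩
  ∑ m f          ≡⟨ +-identityʳ (∑ m f) ⟨
  ∑ m f + 0ℚ     ≡⟨ cong (_+_ (∑ m f)) (vanish m (≤′⇒≤ n≤′m) (n<1+n m)) ⟨
  ∑ (suc m) f    ∎
  where open ≡-Reasoning

∑-*-∑ : ∀ n m (z α : ℕ → ℚ) (b : ℕ → ℕ → ℚ) →
  ∑ n (λ i → z i * ∑ m (λ h → α h * b h i)) ≡ ∑ m (λ h → α h * ∑ n (λ i → b h i * z i))
∑-*-∑ n m z α b = begin
  ∑ n (λ i → z i * ∑ m (λ h → α h * b h i))        ≡⟨ ∑-cong n (λ i _ → *-distribˡ-∑ m (z i) _) ⟩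
  ∑ n (λ i → ∑ m (λ h → z i * (α h * b h i)))      ≡⟨ ∑-swap n m _ ⟩
  ∑ m (λ h → ∑ n (λ i → z i * (α h * b h i)))      ≡⟨ ∑-cong m (λ h _ → ∑-cong n (λ i _ → rearrange h i)) ⟩
  ∑ m (λ h → ∑ n (λ i → α h * (b h i * z i)))      ≡⟨ ∑-cong m (λ h _ → *-distribˡ-∑ n (α h) _) ⟨
  ∑ m (λ h → α h * ∑ n (λ i → b h i * z i))        ∎
  where
  open ≡-Reasoning
  rearrange : ∀ h i → z i * (α h * b h i) ≡ α h * (b h i * z i)
  rearrange h i = trans (x∙yz≈y∙xz (z i) (α h) (b h i)) (cong (_*_ (α h)) (*-comm (z i) (b h i)))

shift : (ℕ → ℚ) → ℕ → ℚ
shift g zero    = 0ℚ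
shift g (suc h) = g h

∑-shift : ∀ n (g b : ℕ → ℚ) → ∑ (suc n) (λ h → shift g h * b h) ≡ ∑ n (λ h → g h * b (suc h))
∑-shift zero    g b = trans (+-identityˡ _) (*-zeroˡ (b 0))
∑-shift (suc n) g b = cong (_+ g n * b (suc n)) (∑-shift n g b)

∑-shift-+ : ∀ m (f g b : ℕ → ℚ) → f (suc m) ≡ 0ℚ →
  ∑ (suc m) (λ h → g h * b (suc h) + f h * b h) ≡ ∑ (suc (suc m)) (λ h → (shift g h + f h) * b h)
∑-shift-+ m f g b f[1+m]≡0 = begin
  ∑ (suc m) (λ h → g h * b (suc h) + f h * b h)
    ≡⟨ ∑-+ (suc m) _ _ ⟩
  ∑ (suc m) (λ h → g h * b (suc h)) + ∑ (suc m) (λ h → f h * b h)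
    ≡⟨ cong₂ _+_ (∑-shift (suc m) g b) top-term ⟨
  ∑ (suc (suc m)) (λ h → shift g h * b h) + ∑ (suc (suc m)) (λ h → f h * b h)
    ≡⟨ ∑-+ (suc (suc m)) _ _ ⟨
  ∑ (suc (suc m)) (λ h → shift g h * b h + f h * b h)
    ≡⟨ ∑-cong (suc (suc m)) (λ h _ → *-distribʳ-+ (b h) (shift g h) (f h)) ⟨
  ∑ (suc (suc m)) (λ h → (shift g h + f h) * b h)
    ∎
  where
  open ≡-Reasoning
  top-term : ∑ (suc (suc m)) (λ h → f h * b h) ≡ ∑ (suc m) (λ h → f h * b h)
  top-term = trans
    (cong (_+_ (∑ (suc m) (λ h → f h * b h))) (trans (cong (_* b (suc m)) f[1+m]≡0) (*-zeroˡ (b (suc m)))))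
    (+-identityʳ _)

single : ℕ → ℚ → ℕ → ℚ
single s t i with i ℕ.≟ s
... | yes _ = t
... | no  _ = 0ℚ

single-≡ : ∀ s t → single s t s ≡ t
single-≡ s t with s ℕ.≟ s
... | yes _   = refl
... | no  s≢s = ⊥-elim (s≢s refl)

single-≢ : ∀ {s i} t → i ≢ s → single s t i ≡ 0ℚ
single-≢ {s} {i} t i≢s with i ℕ.≟ s
... | yes i≡s = ⊥-elim (i≢s i≡s)
... | no  _   = refl

∑-single-* : ∀ n {s} t (f : ℕ → ℚ) → s < n → ∑ n (λ i → single s t i * f i) ≡ t * f s
∑-single-* n {s} t f s<n = trans
  (∑-single n s s<n (λ i _ i≢s → trans (cong (_* f i) (single-≢ t i≢s)) (*-zeroˡ (f i))))
  (cong (_* f s) (single-≡ s t))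

-- sumRange lo hi recurses on suc hi ∸ lo, which is abstracted here and below.
sumRange-empty : ∀ {lo hi} (f : ℕ → ℚ) → hi < lo → sumRange lo hi f ≡ 0ℚ
sumRange-empty {lo} {hi} f hi<lo with suc hi ∸ lo | ℕ.m≤n⇒m∸n≡0 hi<lo
... | _ | refl = refl

sumRange-snoc : ∀ {lo hi} (f : ℕ → ℚ) → lo ≤ suc hi → sumRange lo (suc hi) f ≡ sumRange lo hi f + f (suc hi)
sumRange-snoc {lo} {hi} f lo≤1+hi with suc (suc hi) ∸ lo | ℕ.+-∸-assoc 1 lo≤1+hi
... | _ | refl = cong (_+_ (sumRange lo hi f)) (cong f (m+[n∸m]≡n lo≤1+hi))

sumRange≡∑-prefix : ∀ lo hi {f : ℕ → ℚ} → (∀ i → i < lo → f i ≡ 0ℚ) → sumRange lo hi f ≡ ∑ (suc hi) f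
sumRange≡∑-prefix zero    zero     below = refl
sumRange≡∑-prefix (suc lo) zero {f} below = trans (sumRange-empty {suc lo} f z<s) (sym (trans (+-identityˡ (f 0)) (below 0 z<s)))
sumRange≡∑-prefix lo (suc hi) {f} below with lo ℕ.≤? suc hi
... | yes lo≤1+hi = trans (sumRange-snoc f lo≤1+hi) (cong (_+ f (suc hi)) (sumRange≡∑-prefix lo hi below))
... | no  lo≰1+hi = trans (sumRange-empty f (≰⇒> lo≰1+hi))
      (sym (∑≡0 (suc (suc hi)) (λ i i<2+hi → below i (<-≤-trans i<2+hi (≰⇒> lo≰1+hi)))))

sumRange≡∑ : ∀ {lo hi N} {f : ℕ → ℚ} → hi < N →
  (∀ i → i < lo → f i ≡ 0ℚ) → (∀ i → hi < i → i < N → f i ≡ 0ℚ) → sumRange lo hi f ≡ ∑ N f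
sumRange≡∑ {lo} {hi} hi<N below above = trans (sumRange≡∑-prefix lo hi below) (∑-extend (≤⇒≤′ hi<N) above)

-- Binomial coefficients

0<nCk : ∀ {n k} → k ≤ n → 0 < n C k
0<nCk {n}     {zero}  _         = z<s
0<nCk {suc n} {suc k} (s≤s k≤n) =
  subst (0 <_) (nCk+nC[k+1]≡[n+1]C[k+1] n k) (<-≤-trans (0<nCk k≤n) (ℕ.m≤m+n (n C k) _))

ℕ→ℚ[nCk]≢0 : ∀ {n k} → k ≤ n → ℕ→ℚ (n C k) ≢ 0ℚ
ℕ→ℚ[nCk]≢0 k≤n eq = ℕ.<⇒≢ (0<nCk k≤n) (sym (ℕ→ℚ-injective eq))

[k+1]*[n+1]C[k+1]≡[n+1]*nCk : ∀ n k → suc k ℕ.* (suc n C suc k) ≡ suc n ℕ.* (n C k)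
[k+1]*[n+1]C[k+1]≡[n+1]*nCk zero    zero    = refl
[k+1]*[n+1]C[k+1]≡[n+1]*nCk zero    (suc k) =
  trans (cong (suc (suc k) ℕ.*_) (k>n⇒nCk≡0 (s<s (z<s {k})))) (ℕ.*-zeroʳ (suc (suc k)))
[k+1]*[n+1]C[k+1]≡[n+1]*nCk (suc n) zero    =
  trans (ℕ.*-identityˡ _) (trans (nC1≡n (suc (suc n))) (sym (ℕ.*-identityʳ (suc (suc n)))))
[k+1]*[n+1]C[k+1]≡[n+1]*nCk (suc n) (suc k) = begin
  (2 ℕ.+ k) ℕ.* (suc (suc n) C suc (suc k))   ≡⟨ cong ((2 ℕ.+ k) ℕ.*_) (nCk+nC[k+1]≡[n+1]C[k+1] (suc n) (suc k)) ⟨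
  (2 ℕ.+ k) ℕ.* (a ℕ.+ b)                     ≡⟨ split a b k ⟩
  (1 ℕ.+ k) ℕ.* a ℕ.+ a ℕ.+ (2 ℕ.+ k) ℕ.* b   ≡⟨ cong₂ (λ u v → u ℕ.+ a ℕ.+ v) ([k+1]*[n+1]C[k+1]≡[n+1]*nCk n k)
                                                                              ([k+1]*[n+1]C[k+1]≡[n+1]*nCk n (suc k)) ⟩
  (1 ℕ.+ n) ℕ.* c ℕ.+ a ℕ.+ (1 ℕ.+ n) ℕ.* d   ≡⟨ regroup c d a n ⟩
  a ℕ.+ (1 ℕ.+ n) ℕ.* (c ℕ.+ d)               ≡⟨ cong (λ t → a ℕ.+ (1 ℕ.+ n) ℕ.* t) (nCk+nC[k+1]≡[n+1]C[k+1] n k) ⟩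
  (2 ℕ.+ n) ℕ.* a                             ∎
  where
  open ≡-Reasoning
  a = suc n C suc k
  b = suc n C suc (suc k)
  c = n C k
  d = n C suc k
  split : ∀ a b k → (2 ℕ.+ k) ℕ.* (a ℕ.+ b) ≡ (1 ℕ.+ k) ℕ.* a ℕ.+ a ℕ.+ (2 ℕ.+ k) ℕ.* b
  split = ℕ-Solver.solve-∀
  regroup : ∀ c d a n → (1 ℕ.+ n) ℕ.* c ℕ.+ a ℕ.+ (1 ℕ.+ n) ℕ.* d ≡ a ℕ.+ (1 ℕ.+ n) ℕ.* (c ℕ.+ d)
  regroup = ℕ-Solver.solve-∀

-- binom(n, i - h); for n = ν - k it is the coefficient of x_i and of -y_i in (c_h).
shiftedBinom : ℕ → ℕ → ℕ → ℚ
shiftedBinom n h i = binZ n (+ i ℤ.- + h)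

shiftedBinom-zero : ∀ n i → shiftedBinom n 0 i ≡ ℕ→ℚ (n C i)
shiftedBinom-zero n i = cong (binZ n) (ℤ.+-identityʳ (+ i))

shiftedBinom-suc : ∀ n h i → shiftedBinom n (suc h) (suc i) ≡ shiftedBinom n h i
shiftedBinom-suc n h i = cong (binZ n) ([1+m]-[1+n]≡m-n i h)

shiftedBinom-below : ∀ n {h i} → i < h → shiftedBinom n h i ≡ 0ℚ
shiftedBinom-below n {suc h} {zero}  _         = refl
shiftedBinom-below n {suc h} {suc i} (s<s i<h) = trans (shiftedBinom-suc n h i) (shiftedBinom-below n i<h)

shiftedBinom-above : ∀ n {h i} → h ℕ.+ n < i → shiftedBinom n h i ≡ 0ℚ
shiftedBinom-above n {zero}  {i}     n<i       = trans (shiftedBinom-zero n i) (cong ℕ→ℚ (k>n⇒nCk≡0 n<i))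
shiftedBinom-above n {suc h} {suc i} (s<s h+n<i) = trans (shiftedBinom-suc n h i) (shiftedBinom-above n h+n<i)

shiftedBinom-+ : ∀ n h j → shiftedBinom n h (h ℕ.+ j) ≡ ℕ→ℚ (n C j)
shiftedBinom-+ n zero    j = shiftedBinom-zero n j
shiftedBinom-+ n (suc h) j = trans (shiftedBinom-suc n h (h ℕ.+ j)) (shiftedBinom-+ n h j)

shiftedBinom-pascal : ∀ n h i → shiftedBinom (suc n) h i ≡ shiftedBinom n h i + shiftedBinom n (suc h) i
shiftedBinom-pascal n zero zero = begin
  shiftedBinom (suc n) 0 0                  ≡⟨ shiftedBinom-zero (suc n) 0 ⟩
  1ℚ                                        ≡⟨ cong (_+ 0ℚ) (shiftedBinom-zero n 0) ⟨
  shiftedBinom n 0 0 + 0ℚ                   ∎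
  where open ≡-Reasoning
shiftedBinom-pascal n zero (suc i) = begin
  shiftedBinom (suc n) 0 (suc i)                       ≡⟨ shiftedBinom-zero (suc n) (suc i) ⟩
  ℕ→ℚ (suc n C suc i)                                  ≡⟨ cong ℕ→ℚ (nCk+nC[k+1]≡[n+1]C[k+1] n i) ⟨
  ℕ→ℚ (n C i ℕ.+ n C suc i)                            ≡⟨ ℕ→ℚ-+ (n C i) (n C suc i) ⟩
  ℕ→ℚ (n C i) + ℕ→ℚ (n C suc i)                        ≡⟨ +-comm (ℕ→ℚ (n C i)) (ℕ→ℚ (n C suc i)) ⟩
  ℕ→ℚ (n C suc i) + ℕ→ℚ (n C i)                        ≡⟨ cong₂ _+_ (shiftedBinom-zero n (suc i))
                                                                     (trans (shiftedBinom-suc n 0 i) (shiftedBinom-zero n i)) ⟨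
  shiftedBinom n 0 (suc i) + shiftedBinom n 1 (suc i)  ∎
  where open ≡-Reasoning
shiftedBinom-pascal n (suc h) zero    = refl
shiftedBinom-pascal n (suc h) (suc i) = begin
  shiftedBinom (suc n) (suc h) (suc i)
    ≡⟨ shiftedBinom-suc (suc n) h i ⟩
  shiftedBinom (suc n) h i
    ≡⟨ shiftedBinom-pascal n h i ⟩
  shiftedBinom n h i + shiftedBinom n (suc h) i
    ≡⟨ cong₂ _+_ (shiftedBinom-suc n h i) (shiftedBinom-suc n (suc h) i) ⟨
  shiftedBinom n (suc h) (suc i) + shiftedBinom n (2 ℕ.+ h) (suc i)
    ∎
  where open ≡-Reasoning

shiftedBinom-absorb : ∀ n h i →
  (ℕ→ℚ i - ℕ→ℚ h) * shiftedBinom (suc n) h i ≡ ℕ→ℚ (suc n) * shiftedBinom n (suc h) i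
shiftedBinom-absorb n zero zero = sym (*-zeroʳ (ℕ→ℚ (suc n)))
shiftedBinom-absorb n zero (suc i) = begin
  (ℕ→ℚ (suc i) - 0ℚ) * shiftedBinom (suc n) 0 (suc i)
    ≡⟨ cong₂ _*_ (+-identityʳ (ℕ→ℚ (suc i))) (shiftedBinom-zero (suc n) (suc i)) ⟩
  ℕ→ℚ (suc i) * ℕ→ℚ (suc n C suc i)
    ≡⟨ ℕ→ℚ-* (suc i) (suc n C suc i) ⟨
  ℕ→ℚ (suc i ℕ.* (suc n C suc i))
    ≡⟨ cong ℕ→ℚ ([k+1]*[n+1]C[k+1]≡[n+1]*nCk n i) ⟩
  ℕ→ℚ (suc n ℕ.* (n C i))
    ≡⟨ ℕ→ℚ-* (suc n) (n C i) ⟩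
  ℕ→ℚ (suc n) * ℕ→ℚ (n C i)
    ≡⟨ cong (_*_ (ℕ→ℚ (suc n))) (trans (shiftedBinom-suc n 0 i) (shiftedBinom-zero n i)) ⟨
  ℕ→ℚ (suc n) * shiftedBinom n 1 (suc i)
    ∎
  where open ≡-Reasoning
shiftedBinom-absorb n (suc h) zero = trans (*-zeroʳ (0ℚ - ℕ→ℚ (suc h))) (sym (*-zeroʳ (ℕ→ℚ (suc n))))
shiftedBinom-absorb n (suc h) (suc i) = begin
  (ℕ→ℚ (suc i) - ℕ→ℚ (suc h)) * shiftedBinom (suc n) (suc h) (suc i)
    ≡⟨ cong₂ _*_ (ℕ→ℚ-suc-minus-suc i h) (shiftedBinom-suc (suc n) h i) ⟩
  (ℕ→ℚ i - ℕ→ℚ h) * shiftedBinom (suc n) h i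
    ≡⟨ shiftedBinom-absorb n h i ⟩
  ℕ→ℚ (suc n) * shiftedBinom n (suc h) i
    ≡⟨ cong (_*_ (ℕ→ℚ (suc n))) (shiftedBinom-suc n (suc h) i) ⟨
  ℕ→ℚ (suc n) * shiftedBinom n (2 ℕ.+ h) (suc i)
    ∎
  where open ≡-Reasoning

shiftedBinom-factor : ∀ n h i a →
  (ℕ→ℚ i - a) * shiftedBinom (suc n) h i
    ≡ (ℕ→ℚ (suc n) + ℕ→ℚ h - a) * shiftedBinom n (suc h) i + (ℕ→ℚ h - a) * shiftedBinom n h i
shiftedBinom-factor n h i a = begin
  (I - a) * B′
    ≡⟨ split I H a B′ ⟩
  (I - H) * B′ + (H - a) * B′
    ≡⟨ cong₂ (λ u v → u + (H - a) * v) (shiftedBinom-absorb n h i) (shiftedBinom-pascal n h i) ⟩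
  N * B₁ + (H - a) * (B₀ + B₁)
    ≡⟨ regroup N H a B₀ B₁ ⟩
  (N + H - a) * B₁ + (H - a) * B₀
    ∎
  where
  open ≡-Reasoning
  I = ℕ→ℚ i
  H = ℕ→ℚ h
  N = ℕ→ℚ (suc n)
  B′ = shiftedBinom (suc n) h i
  B₀ = shiftedBinom n h i
  B₁ = shiftedBinom n (suc h) i
  split : ∀ I H a B → (I - a) * B ≡ (I - H) * B + (H - a) * B
  split = solve 4 (λ I H a B → (I :- a) :* B := (I :- H) :* B :+ (H :- a) :* B) refl
  regroup : ∀ N H a B₀ B₁ → N * B₁ + (H - a) * (B₀ + B₁) ≡ (N + H - a) * B₁ + (H - a) * B₀
  regroup = solve 5 (λ N H a B₀ B₁ → N :* B₁ :+ (H :- a) :* (B₀ :+ B₁) := (N :+ H :- a) :* B₁ :+ (H :- a) :* B₀) refl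

-- Expansions in shifted binomial coefficients

-- For n = ν - k and m = k these are the combinations of the constraint rows (c_0), …, (c_k).
record BinomialExpansion (n m : ℕ) (F : ℕ → ℚ) : Set where
  field
    coeff          : ℕ → ℚ
    coeff-vanishes : ∀ h → m < h → coeff h ≡ 0ℚ
    expands        : ∀ i → F i ≡ ∑ (suc m) (λ h → coeff h * shiftedBinom n h i)

open BinomialExpansion

expansion-cong : ∀ {n m F G} → (∀ i → F i ≡ G i) → BinomialExpansion n m F → BinomialExpansion n m G
expansion-cong F≗G E = record
  { coeff          = coeff E
  ; coeff-vanishes = coeff-vanishes E
  ; expands        = λ i → trans (sym (F≗G i)) (expands E i)
  }

expansion-binomial : ∀ n → BinomialExpansion n 0 (λ i → ℕ→ℚ (n C i))
expansion-binomial n = record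
  { coeff          = single 0 1ℚ
  ; coeff-vanishes = λ { (suc h) _ → refl }
  ; expands        = λ i → sym (trans (+-identityˡ _) (trans (*-identityˡ _) (shiftedBinom-zero n i)))
  }

expansion-step : ∀ {n m F} (c p q : ℕ → ℚ) →
  (∀ h i → c i * shiftedBinom (suc n) h i ≡ p h * shiftedBinom n (suc h) i + q h * shiftedBinom n h i) →
  BinomialExpansion (suc n) m F → BinomialExpansion n (suc m) (λ i → c i * F i)
expansion-step {n} {m} {F} c p q recurrence E = record
  { coeff          = λ h → shift αp h + αq h
  ; coeff-vanishes = vanishes
  ; expands        = expands′
  }
  where
  open ≡-Reasoning
  α = coeff E
  αp αq : ℕ → ℚ
  αp h = α h * p h
  αq h = α h * q h
  B = shiftedBinom n
  vanishes : ∀ h → suc m < h → shift αp h + αq h ≡ 0ℚ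
  vanishes (suc h) (s<s m<h) = cong₂ _+_
    (trans (cong (_* p h) (coeff-vanishes E h m<h)) (*-zeroˡ (p h)))
    (trans (cong (_* q (suc h)) (coeff-vanishes E (suc h) (m<n⇒m<1+n m<h))) (*-zeroˡ (q (suc h))))
  αq-vanishes : αq (suc m) ≡ 0ℚ
  αq-vanishes = trans (cong (_* q (suc m)) (coeff-vanishes E (suc m) (n<1+n m))) (*-zeroˡ (q (suc m)))
  expands′ : ∀ i → c i * F i ≡ ∑ (suc (suc m)) (λ h → (shift αp h + αq h) * B h i)
  expands′ i = begin
    c i * F i                                                   ≡⟨ cong (_*_ (c i)) (expands E i) ⟩
    c i * ∑ (suc m) (λ h → α h * shiftedBinom (suc n) h i)      ≡⟨ *-distribˡ-∑ (suc m) (c i) _ ⟩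
    ∑ (suc m) (λ h → c i * (α h * shiftedBinom (suc n) h i))    ≡⟨ ∑-cong (suc m) (λ h _ → step h) ⟩
    ∑ (suc m) (λ h → αp h * B (suc h) i + αq h * B h i)         ≡⟨ ∑-shift-+ m αq αp (λ h → B h i) αq-vanishes ⟩
    ∑ (suc (suc m)) (λ h → (shift αp h + αq h) * B h i)         ∎
    where
    step : ∀ h → c i * (α h * shiftedBinom (suc n) h i) ≡ αp h * B (suc h) i + αq h * B h i
    step h = begin
      c i * (α h * shiftedBinom (suc n) h i)              ≡⟨ x∙yz≈y∙xz (c i) (α h) _ ⟩
      α h * (c i * shiftedBinom (suc n) h i)              ≡⟨ cong (_*_ (α h)) (recurrence h i) ⟩
      α h * (p h * B (suc h) i + q h * B h i)             ≡⟨ *-distribˡ-+ (α h) _ _ ⟩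
      α h * (p h * B (suc h) i) + α h * (q h * B h i)     ≡⟨ cong₂ _+_ (*-assoc (α h) (p h) _) (*-assoc (α h) (q h) _) ⟨
      αp h * B (suc h) i + αq h * B h i                   ∎

expansion-pascal : ∀ {n m F} → BinomialExpansion (suc n) m F → BinomialExpansion n (suc m) F
expansion-pascal {n} E = expansion-cong (λ i → *-identityˡ _)
  (expansion-step (λ _ → 1ℚ) (λ _ → 1ℚ) (λ _ → 1ℚ) pascal E)
  where
  pascal : ∀ h i → 1ℚ * shiftedBinom (suc n) h i ≡ 1ℚ * shiftedBinom n (suc h) i + 1ℚ * shiftedBinom n h i
  pascal h i = begin
    1ℚ * B′                 ≡⟨ *-identityˡ B′ ⟩
    B′                      ≡⟨ shiftedBinom-pascal n h i ⟩
    B₀ + B₁                 ≡⟨ +-comm B₀ B₁ ⟩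
    B₁ + B₀                 ≡⟨ cong₂ _+_ (*-identityˡ B₁) (*-identityˡ B₀) ⟨
    1ℚ * B₁ + 1ℚ * B₀       ∎
    where
    open ≡-Reasoning
    B′ = shiftedBinom (suc n) h i
    B₀ = shiftedBinom n h i
    B₁ = shiftedBinom n (suc h) i

expansion-factor : ∀ {n m F} a → BinomialExpansion (suc n) m F →
  BinomialExpansion n (suc m) (λ i → (ℕ→ℚ i - a) * F i)
expansion-factor {n} a =
  expansion-step (λ i → ℕ→ℚ i - a) (λ h → ℕ→ℚ (suc n) + ℕ→ℚ h - a) (λ h → ℕ→ℚ h - a)
    (λ h i → shiftedBinom-factor n h i a)

leading-coeff : ∀ {n m F} (E : BinomialExpansion n m F) → coeff E m ≡ F (m ℕ.+ n)
leading-coeff {n} {m} {F} E = sym (begin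
  F (m ℕ.+ n)
    ≡⟨ expands E (m ℕ.+ n) ⟩
  ∑ (suc m) (λ h → α h * shiftedBinom n h (m ℕ.+ n))
    ≡⟨ ∑-single (suc m) m (n<1+n m) off-diagonal ⟩
  α m * shiftedBinom n m (m ℕ.+ n)
    ≡⟨ cong (_*_ (α m)) (trans (shiftedBinom-+ n m n) (cong ℕ→ℚ (nCn≡1 n))) ⟩
  α m * 1ℚ
    ≡⟨ *-identityʳ (α m) ⟩
  α m
    ∎)
  where
  open ≡-Reasoning
  α = coeff E
  off-diagonal : ∀ h → h < suc m → h ≢ m → α h * shiftedBinom n h (m ℕ.+ n) ≡ 0ℚ
  off-diagonal h h<1+m h≢m = trans
    (cong (_*_ (α h)) (shiftedBinom-above n (ℕ.+-monoˡ-< n (≤∧≢⇒< (≤-pred h<1+m) h≢m))))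
    (*-zeroʳ (α h))

rootPoly : List ℕ → ℕ → ℚ
rootPoly []      i = 1ℚ
rootPoly (a ∷ T) i = (ℕ→ℚ i - ℕ→ℚ a) * rootPoly T i

rootPoly-root : ∀ {T a} → a ∈ T → rootPoly T a ≡ 0ℚ
rootPoly-root {b ∷ T} {a} (here refl) = trans (cong (_* rootPoly T a) (+-inverseʳ (ℕ→ℚ a))) (*-zeroˡ (rootPoly T a))
rootPoly-root {b ∷ T} {a} (there a∈T) =
  trans (cong (_*_ (ℕ→ℚ a - ℕ→ℚ b)) (rootPoly-root a∈T)) (*-zeroʳ (ℕ→ℚ a - ℕ→ℚ b))

rootPoly-≢0 : ∀ {T j} → All (_≢ j) T → rootPoly T j ≢ 0ℚ
rootPoly-≢0 []             ()
rootPoly-≢0 (a≢j ∷ T≢j) = *-≢0 (ℕ→ℚ-minus-≢0 (a≢j ∘ sym)) (rootPoly-≢0 T≢j)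

binomial*rootPoly-expansion : ∀ {N} n m T → m ℕ.+ n ≡ N → length T ≤ m →
  BinomialExpansion n m (λ i → ℕ→ℚ (N C i) * rootPoly T i)
binomial*rootPoly-expansion n zero    []      refl _ =
  expansion-cong (λ i → sym (*-identityʳ _)) (expansion-binomial n)
binomial*rootPoly-expansion n (suc m) []      eq   _ =
  expansion-pascal (binomial*rootPoly-expansion (suc n) m [] (trans (+-suc m n) eq) z≤n)
binomial*rootPoly-expansion {N} n (suc m) (a ∷ T) eq (s≤s |T|≤m) =
  expansion-cong (λ i → x∙yz≈y∙xz (ℕ→ℚ i - ℕ→ℚ a) (ℕ→ℚ (N C i)) (rootPoly T i))
    (expansion-factor (ℕ→ℚ a) (binomial*rootPoly-expansion (suc n) m T (trans (+-suc m n) eq) |T|≤m))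

-- coef ν Y X j unfolds to divℚ (ratioProduct ν j (others ν Y X j)) (ℕ→ℚ (ν C j)).
ratioProduct : ℕ → ℕ → List ℕ → ℚ
ratioProduct ν j = foldr (λ a acc → divℚ (ℤ→ℚ (+ ν ℤ.- + a)) (ℤ→ℚ (+ j ℤ.- + a)) * acc) 1ℚ

ratioProduct*rootPoly : ∀ ν j {T} → All (_≢ j) T → ratioProduct ν j T * rootPoly T j ≡ rootPoly T ν
ratioProduct*rootPoly ν j []                = *-identityˡ 1ℚ
ratioProduct*rootPoly ν j {a ∷ T} (a≢j ∷ T≢j) = begin
  (divℚ r s * ratioProduct ν j T) * ((ℕ→ℚ j - ℕ→ℚ a) * rootPoly T j)
    ≡⟨ cong (λ t → (divℚ r s * ratioProduct ν j T) * (t * rootPoly T j)) s≡j-a ⟨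
  (divℚ r s * ratioProduct ν j T) * (s * rootPoly T j)
    ≡⟨ *-interchange (divℚ r s) (ratioProduct ν j T) s (rootPoly T j) ⟩
  (divℚ r s * s) * (ratioProduct ν j T * rootPoly T j)
    ≡⟨ cong₂ _*_ (divℚ[p,q]*q≡p r s s≢0) (ratioProduct*rootPoly ν j T≢j) ⟩
  r * rootPoly T ν
    ≡⟨ cong (_* rootPoly T ν) (ℤ→ℚ-minus (+ ν) (+ a)) ⟩
  (ℕ→ℚ ν - ℕ→ℚ a) * rootPoly T ν
    ∎
  where
  open ≡-Reasoning
  r = ℤ→ℚ (+ ν ℤ.- + a)
  s = ℤ→ℚ (+ j ℤ.- + a)
  s≡j-a : s ≡ ℕ→ℚ j - ℕ→ℚ a
  s≡j-a = ℤ→ℚ-minus (+ j) (+ a)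
  s≢0 : s ≢ 0ℚ
  s≢0 s≡0 = ℕ→ℚ-minus-≢0 (a≢j ∘ sym) (trans (sym s≡j-a) s≡0)

-- Linear dependence

-- The vectors are v i (i ∈ S) and v i h is the coordinate h of v i.
record LinearDependence (N : ℕ) (v : ℕ → ℕ → ℚ) (H S : List ℕ) : Set where
  field
    weight     : ℕ → ℚ
    supported  : ∀ i → i ∉ S → weight i ≡ 0ℚ
    witness    : ℕ
    witness∈S  : witness ∈ S
    nontrivial : weight witness ≢ 0ℚ
    relation   : ∀ h → h ∈ H → ∑ N (λ i → weight i * v i h) ≡ 0ℚ

weaken-dependence : ∀ {N v H H′ S} → (∀ {h} → h ∈ H → h ∈ H′) →
  LinearDependence N v H′ S → LinearDependence N v H S
weaken-dependence H⊆H′ D = record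
  { weight     = weight
  ; supported  = supported
  ; witness    = witness
  ; witness∈S  = witness∈S
  ; nontrivial = nontrivial
  ; relation   = λ h h∈H → relation h (H⊆H′ h∈H)
  }
  where open LinearDependence D

null-vector-dependence : ∀ {N v H S s} → s < N → (∀ h → h ∈ H → v s h ≡ 0ℚ) → LinearDependence N v H (s ∷ S)
null-vector-dependence {N} {v} {s = s} s<N vₛ≡0 = record
  { weight     = single s 1ℚ
  ; supported  = λ i i∉ → single-≢ 1ℚ (i∉ ∘ here)
  ; witness    = s
  ; witness∈S  = here refl
  ; nontrivial = λ eq → 1≢0 (trans (sym (single-≡ s 1ℚ)) eq)
  ; relation   = λ h h∈H → trans (∑-single-* N 1ℚ (λ i → v i h) s<N) (trans (*-identityˡ (v s h)) (vₛ≡0 h h∈H))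
  }

-- Clears coordinate c of every v i against the pivot v s, cross-multiplying to avoid division.
eliminate : (ℕ → ℕ → ℚ) → ℕ → ℕ → ℕ → ℕ → ℚ
eliminate v s c i h = v s c * v i h - v i c * v s h

lift-weight : ℕ → (ℕ → ℕ → ℚ) → ℕ → ℕ → (ℕ → ℚ) → ℕ → ℚ
lift-weight N v s c w i = v s c * w i + single s (- ∑ N (λ i → w i * v i c)) i

∑-lift-weight : ∀ N v {s} c w h → s < N →
  ∑ N (λ i → lift-weight N v s c w i * v i h) ≡ ∑ N (λ i → w i * eliminate v s c i h)
∑-lift-weight N v {s} c w h s<N = begin
  ∑ N (λ i → (v s c * w i + single s (- M) i) * v i h)
    ≡⟨ ∑-cong N (λ i _ → *-distribʳ-+ (v i h) (v s c * w i) (single s (- M) i)) ⟩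
  ∑ N (λ i → v s c * w i * v i h + single s (- M) i * v i h)
    ≡⟨ ∑-+ N _ _ ⟩
  ∑ N (λ i → v s c * w i * v i h) + ∑ N (λ i → single s (- M) i * v i h)
    ≡⟨ cong₂ _+_ (trans (∑-cong N (λ i _ → *-assoc (v s c) (w i) (v i h))) (sym (*-distribˡ-∑ N (v s c) _)))
                 (∑-single-* N (- M) (λ i → v i h) s<N) ⟩
  v s c * A + - M * v s h
    ≡⟨ rearrange (v s c) (v s h) A M ⟩
  v s c * A - v s h * M
    ≡⟨ cong₂ _-_ (*-distribˡ-∑ N (v s c) _) (*-distribˡ-∑ N (v s h) _) ⟩
  ∑ N (λ i → v s c * (w i * v i h)) - ∑ N (λ i → v s h * (w i * v i c))
    ≡⟨ ∑-minus N _ _ ⟨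
  ∑ N (λ i → v s c * (w i * v i h) - v s h * (w i * v i c))
    ≡⟨ ∑-cong N (λ i _ → distribute (w i) (v s c) (v i h) (v i c) (v s h)) ⟨
  ∑ N (λ i → w i * eliminate v s c i h)
    ∎
  where
  open ≡-Reasoning
  M = ∑ N (λ i → w i * v i c)
  A = ∑ N (λ i → w i * v i h)
  rearrange : ∀ a b A M → a * A + - M * b ≡ a * A - b * M
  rearrange = solve 4 (λ a b A M → a :* A :+ (:- M) :* b := a :* A :- b :* M) refl
  distribute : ∀ x a b c d → x * (a * b - c * d) ≡ a * (x * b) - d * (x * c)
  distribute = solve 5 (λ x a b c d → x :* (a :* b :- c :* d) := a :* (x :* b) :- d :* (x :* c)) refl

eliminate-dependence : ∀ {N v H S s c} → s < N → All (s ≢_) S → v s c ≢ 0ℚ →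
  LinearDependence N (eliminate v s c) H S → LinearDependence N v (c ∷ H) (s ∷ S)
eliminate-dependence {N} {v} {H} {S} {s} {c} s<N s≢S vₛc≢0 D = record
  { weight     = w
  ; supported  = supported
  ; witness    = D.witness
  ; witness∈S  = there D.witness∈S
  ; nontrivial = nontrivial
  ; relation   = relation
  }
  where
  module D = LinearDependence D
  w = lift-weight N v s c D.weight
  M = ∑ N (λ i → D.weight i * v i c)
  supported : ∀ i → i ∉ s ∷ S → w i ≡ 0ℚ
  supported i i∉ = cong₂ _+_
    (trans (cong (_*_ (v s c)) (D.supported i (i∉ ∘ there))) (*-zeroʳ (v s c)))
    (single-≢ (- M) (i∉ ∘ here))
  nontrivial : w D.witness ≢ 0ℚ
  nontrivial = subst (_≢ 0ℚ)
    (sym (trans (cong (_+_ (v s c * D.weight D.witness)) (single-≢ (- M) (All.lookup s≢S D.witness∈S ∘ sym)))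
                (+-identityʳ _)))
    (*-≢0 vₛc≢0 D.nontrivial)
  eliminated-c≡0 : ∀ i → eliminate v s c i c ≡ 0ℚ
  eliminated-c≡0 i = trans (cong (_- v i c * v s c) (*-comm (v s c) (v i c))) (+-inverseʳ (v i c * v s c))
  relation : ∀ h → h ∈ c ∷ H → ∑ N (λ i → w i * v i h) ≡ 0ℚ
  relation h (here refl) = trans (∑-lift-weight N v c D.weight h s<N)
    (∑≡0 N (λ i _ → trans (cong (_*_ (D.weight i)) (eliminated-c≡0 i)) (*-zeroʳ (D.weight i))))
  relation h (there h∈H) = trans (∑-lift-weight N v c D.weight h s<N) (D.relation h h∈H)

dependent : ∀ N v H S → Unique S → All (_< N) S → length H < length S → LinearDependence N v H S
dependent N v H (s ∷ S) (s≢S ∷ unique) (s<N ∷ S<N) (s≤s |H|≤|S|) with all? (λ h → v s h ≟ 0ℚ) H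
... | yes vₛ≡0 = null-vector-dependence s<N (λ h → All.lookup vₛ≡0)
... | no ¬vₛ≡0 with c , c∈H , vₛc≢0 ← find (¬All⇒Any¬ (λ h → v s h ≟ 0ℚ) H ¬vₛ≡0) =
  weaken-dependence H⊆c∷H′ (eliminate-dependence s<N s≢S vₛc≢0 (dependent N (eliminate v s c) H′ S unique S<N |H′|<|S|))
  where
  H′ = filter (λ h → ¬? (h ℕ.≟ c)) H
  |H′|<|S| : length H′ < length S
  |H′|<|S| = <-≤-trans (filter-notAll (λ h → ¬? (h ℕ.≟ c)) H (Any.map (λ { refl h≢h → h≢h refl }) c∈H)) |H|≤|S|
  H⊆c∷H′ : ∀ {h} → h ∈ H → h ∈ c ∷ H′
  H⊆c∷H′ {h} h∈H with h ℕ.≟ c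
  ... | yes h≡c = here h≡c
  ... | no  h≢c = there (∈-filter⁺ (λ h → ¬? (h ℕ.≟ c)) h∈H h≢c)

-- The constraints of LP_{ν,d,k}

yUpper<ν : ∀ {ν k h} → h ≤ k → k < ν → yUpper ν k h < ν
yUpper<ν {suc ν} {k} {h} h≤k k<ν with h ℕ.≟ k
... | yes _   = n<1+n ν
... | no  h≢k =
  subst (suc ν ∸ k ℕ.+ h <_) (ℕ.m∸n+n≡m (<⇒≤ k<ν)) (ℕ.+-monoʳ-< (suc ν ∸ k) (≤∧≢⇒< h≤k h≢k))

shiftedBinom-above-yUpper : ∀ {ν k h i} → yUpper ν k h < i → i < ν → shiftedBinom (ν ∸ k) h i ≡ 0ℚ
shiftedBinom-above-yUpper {suc ν} {k} {h} {i} yUpper<i i<ν with h ℕ.≟ k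
... | yes _ = ⊥-elim (<⇒≱ yUpper<i (≤-pred i<ν))
... | no  _ = shiftedBinom-above (suc ν ∸ k) (subst (_< i) (ℕ.+-comm (suc ν ∸ k) h) yUpper<i)

lhs≡∑ : ∀ {ν d k h} {y x : ℕ → ℚ} → h ≤ k → k < ν → d < ν → (∀ i → d < i → x i ≡ 0ℚ) →
  lhs ν d k h y x ≡ ∑ ν (λ i → shiftedBinom (ν ∸ k) h i * (x i - y i))
lhs≡∑ {ν} {d} {k} {h} {y} {x} h≤k k<ν d<ν x-vanishes = begin
  lhs ν d k h y x                                   ≡⟨ cong₂ _-_ x-part y-part ⟩
  ∑ ν (λ i → B i * x i) - ∑ ν (λ i → B i * y i)     ≡⟨ ∑-minus ν _ _ ⟨
  ∑ ν (λ i → B i * x i - B i * y i)                 ≡⟨ ∑-cong ν (λ i _ → x[y-z]≈xy-xz (B i) (x i) (y i)) ⟨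
  ∑ ν (λ i → B i * (x i - y i))                     ∎
  where
  open ≡-Reasoning
  B = shiftedBinom (ν ∸ k) h
  B-below : ∀ (z : ℕ → ℚ) i → i < h → B i * z i ≡ 0ℚ
  B-below z i i<h = trans (cong (_* z i) (shiftedBinom-below (ν ∸ k) i<h)) (*-zeroˡ (z i))
  x-part : sumRange h d (λ i → B i * x i) ≡ ∑ ν (λ i → B i * x i)
  x-part = sumRange≡∑ d<ν (B-below x) (λ i d<i _ → trans (cong (_*_ (B i)) (x-vanishes i d<i)) (*-zeroʳ (B i)))
  y-part : sumRange h (yUpper ν k h) (λ i → B i * y i) ≡ ∑ ν (λ i → B i * y i)
  y-part = sumRange≡∑ (yUpper<ν h≤k k<ν) (B-below y)
    (λ i yUpper<i i<ν → trans (cong (_* y i) (shiftedBinom-above-yUpper {ν} {k} {h} yUpper<i i<ν)) (*-zeroˡ (y i)))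

isOther : List ℕ → List ℕ → ℕ → ℕ → Bool
isOther Y X j a = (⌊ a ∈? Y ⌋ ∨ ⌊ a ∈? X ⌋) ∧ not (a ℕ.≡ᵇ j)

∈-others⁻ : ∀ ν Y X j {a} → a ∈ others ν Y X j → a < ν × (a ∈ Y ⊎ a ∈ X) × a ≢ j
∈-others⁻ ν Y X j {a} a∈others
  with a∈upTo , isOther-a ← ∈-filter⁻ (T? ∘ isOther Y X j) {xs = upTo ν} a∈others
  with a∈Y∪X , a≢ᵇj ← Equivalence.to (T-∧ {⌊ a ∈? Y ⌋ ∨ ⌊ a ∈? X ⌋}) isOther-a =
  ∈-upTo⁻ a∈upTo
  , Sum.map (toWitness {a? = a ∈? Y}) (toWitness {a? = a ∈? X}) (Equivalence.to (T-∨ {⌊ a ∈? Y ⌋}) a∈Y∪X)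
  , λ a≡j → subst T (Equivalence.to T-not-≡ a≢ᵇj) (ℕ.≡⇒≡ᵇ a j a≡j)

∈-others⁺ : ∀ {ν Y X j a} → a < ν → a ∈ Y ⊎ a ∈ X → a ≢ j → a ∈ others ν Y X j
∈-others⁺ {ν} {Y} {X} {j} {a} a<ν a∈Y∪X a≢j = ∈-filter⁺ (T? ∘ isOther Y X j) {xs = upTo ν} (∈-upTo⁺ a<ν)
  (Equivalence.from (T-∧ {⌊ a ∈? Y ⌋ ∨ ⌊ a ∈? X ⌋})
    ( Equivalence.from (T-∨ {⌊ a ∈? Y ⌋}) (Sum.map (fromWitness {a? = a ∈? Y}) (fromWitness {a? = a ∈? X}) a∈Y∪X)
    , Equivalence.from T-not-≡ (¬-not (λ a≡ᵇj → a≢j (ℕ.≡ᵇ⇒≡ a j (subst T (sym a≡ᵇj) _))))))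

others-unique : ∀ ν Y X j → Unique (others ν Y X j)
others-unique ν Y X j = Unique.filter⁺ (T? ∘ isOther Y X j) (Unique.upTo⁺ ν)

others≢j : ∀ ν Y X j → All (_≢ j) (others ν Y X j)
others≢j ν Y X j = All.tabulate (λ a∈others → proj₂ (proj₂ (∈-others⁻ ν Y X j a∈others)))

coef*binomial*rootPoly : ∀ ν Y X {j} → j ≤ ν →
  coef ν Y X j * (ℕ→ℚ (ν C j) * rootPoly (others ν Y X j) j) ≡ rootPoly (others ν Y X j) ν
coef*binomial*rootPoly ν Y X {j} j≤ν = begin
  coef ν Y X j * (ℕ→ℚ (ν C j) * P j)
    ≡⟨ *-assoc (coef ν Y X j) (ℕ→ℚ (ν C j)) (P j) ⟨
  coef ν Y X j * ℕ→ℚ (ν C j) * P j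
    ≡⟨ cong (_* P j) (divℚ[p,q]*q≡p (ratioProduct ν j rest) (ℕ→ℚ (ν C j)) (ℕ→ℚ[nCk]≢0 j≤ν)) ⟩
  ratioProduct ν j rest * P j
    ≡⟨ ratioProduct*rootPoly ν j (others≢j ν Y X j) ⟩
  P ν
    ∎
  where
  open ≡-Reasoning
  rest = others ν Y X j
  P = rootPoly rest

restrict : List ℕ → (ℕ → ℚ) → ℕ → ℚ
restrict A w i with i ∈? A
... | yes _ = w i
... | no  _ = 0ℚ

restrict-∈ : ∀ {A i} w → i ∈ A → restrict A w i ≡ w i
restrict-∈ {A} {i} w i∈A with i ∈? A
... | yes _   = refl
... | no  i∉A = ⊥-elim (i∉A i∈A)

restrict-∉ : ∀ {A i} w → i ∉ A → restrict A w i ≡ 0ℚ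
restrict-∉ {A} {i} w i∉A with i ∈? A
... | yes i∈A = ⊥-elim (i∉A i∈A)
... | no  _   = refl

module _ {ν d k : ℕ} (k≤d : k ≤ d) (d<ν : d < ν) {Y X : List ℕ} (base : IsBase ν d k Y X) where

  private
    k<ν : k < ν
    k<ν = ≤-<-trans k≤d d<ν
    X≤d : All (_≤ d) X
    X≤d = proj₁ (proj₂ base)
    independent = proj₁ (proj₂ (proj₂ base))
    B : ℕ → ℕ → ℚ
    B = shiftedBinom (ν ∸ k)

  base<ν : ∀ {i} → i ∈ Y ⊎ i ∈ X → i < ν
  base<ν (inj₁ i∈Y) = All.lookup (proj₁ base) i∈Y
  base<ν (inj₂ i∈X) = ≤-<-trans (All.lookup X≤d i∈X) d<ν

  lhs≡∑-supported : ∀ {h y x} → Supported Y X y x → h ≤ k → lhs ν d k h y x ≡ ∑ ν (λ i → B h i * (x i - y i))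
  lhs≡∑-supported (_ , x-supported) h≤k =
    lhs≡∑ h≤k k<ν d<ν (λ i d<i → x-supported i (λ i∈X → <⇒≱ d<i (All.lookup X≤d i∈X)))

  Y∩X≡∅ : ∀ {j} → j ∈ Y → j ∈ X → ⊥
  Y∩X≡∅ {j} j∈Y j∈X = 1≢0 (trans (sym (single-≡ j 1ℚ)) (proj₁ (independent e e supported lhs≡0) j j∈Y))
    where
    e = single j 1ℚ
    supported : Supported Y X e e
    supported = (λ i i∉Y → single-≢ {j} {i} 1ℚ (λ { refl → i∉Y j∈Y }))
              , (λ i i∉X → single-≢ {j} {i} 1ℚ (λ { refl → i∉X j∈X }))
    lhs≡0 : ∀ h → h ≤ k → lhs ν d k h e e ≡ 0ℚ
    lhs≡0 h h≤k = trans (lhs≡∑-supported supported h≤k)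
      (∑≡0 ν (λ i _ → trans (cong (_*_ (B h i)) (+-inverseʳ (e i))) (*-zeroʳ (B h i))))

  columns-independent : ∀ (w : ℕ → ℚ) → (∀ i → i ∉ Y → i ∉ X → w i ≡ 0ℚ) →
    (∀ h → h ≤ k → ∑ ν (λ i → w i * B h i) ≡ 0ℚ) → ∀ {i} → i ∈ Y ⊎ i ∈ X → w i ≡ 0ℚ
  columns-independent w outside relation = vanishes
    where
    y′ x′ : ℕ → ℚ
    y′ = restrict Y (λ i → - w i)
    x′ = restrict X w
    supported : Supported Y X y′ x′
    supported = (λ i → restrict-∉ _) , (λ i → restrict-∉ w)
    x′-y′≡w : ∀ i → x′ i - y′ i ≡ w i
    x′-y′≡w i with i ∈? X | i ∈? Y
    ... | yes i∈X | yes i∈Y = ⊥-elim (Y∩X≡∅ i∈Y i∈X)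
    ... | yes _   | no  _   = +-identityʳ (w i)
    ... | no  _   | yes _   = trans (+-identityˡ (- - w i)) (neg-involutive (w i))
    ... | no  i∉X | no  i∉Y = sym (outside i i∉Y i∉X)
    lhs≡0 : ∀ h → h ≤ k → lhs ν d k h y′ x′ ≡ 0ℚ
    lhs≡0 h h≤k = begin
      lhs ν d k h y′ x′
        ≡⟨ lhs≡∑-supported supported h≤k ⟩
      ∑ ν (λ i → B h i * (x′ i - y′ i))
        ≡⟨ ∑-cong ν (λ i _ → trans (cong (_*_ (B h i)) (x′-y′≡w i)) (*-comm (B h i) (w i))) ⟩
      ∑ ν (λ i → w i * B h i)
        ≡⟨ relation h h≤k ⟩
      0ℚ
        ∎
      where open ≡-Reasoning
    vanishing = independent y′ x′ supported lhs≡0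
    vanishes : ∀ {i} → i ∈ Y ⊎ i ∈ X → w i ≡ 0ℚ
    vanishes {i} (inj₁ i∈Y) = trans (sym (neg-involutive (w i)))
      (cong -_ (trans (sym (restrict-∈ (λ i → - w i) i∈Y)) (proj₁ vanishing i i∈Y)))
    vanishes {i} (inj₂ i∈X) = trans (sym (restrict-∈ w i∈X)) (proj₂ vanishing i i∈X)

  |others|≤k : ∀ {j} → j ∈ Y ⊎ j ∈ X → length (others ν Y X j) ≤ k
  |others|≤k {j} j∈base with length (others ν Y X j) ℕ.≤? k
  ... | yes |rest|≤k = |rest|≤k
  ... | no  |rest|≰k = ⊥-elim (D.nontrivial (columns-independent D.weight outside relation (in-base D.witness∈S)))
    where
    rest = others ν Y X j
    in-base : ∀ {i} → i ∈ j ∷ rest → i ∈ Y ⊎ i ∈ X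
    in-base (here refl) = j∈base
    in-base (there i∈rest) = proj₁ (proj₂ (∈-others⁻ ν Y X j i∈rest))
    unique : Unique (j ∷ rest)
    unique = All.map (_∘ sym) (others≢j ν Y X j) ∷ others-unique ν Y X j
    below-ν : All (_< ν) (j ∷ rest)
    below-ν = base<ν j∈base ∷ All.tabulate (λ i∈rest → proj₁ (∈-others⁻ ν Y X j i∈rest))
    long : length (upTo (suc k)) < length (j ∷ rest)
    long = subst (_< suc (length rest)) (sym (length-upTo (suc k))) (s≤s (≰⇒> |rest|≰k))
    module D = LinearDependence (dependent ν (λ i h → B h i) (upTo (suc k)) (j ∷ rest) unique below-ν long)
    outside : ∀ i → i ∉ Y → i ∉ X → D.weight i ≡ 0ℚ
    outside i i∉Y i∉X = D.supported i (λ i∈ → [ i∉Y , i∉X ] (in-base i∈))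
    relation : ∀ h → h ≤ k → ∑ ν (λ i → D.weight i * B h i) ≡ 0ℚ
    relation h h≤k = D.relation h (∈-upTo⁺ (s≤s h≤k))

  pairing-with-expansion : ∀ {y x G} → IsBasicSolution ν d k Y X y x → (E : BinomialExpansion (ν ∸ k) k G) →
    ∑ ν (λ i → (x i - y i) * G i) ≡ coeff E k
  pairing-with-expansion {y} {x} {G} (supported , lhs-k≡1 , lhs-h≡0) E = begin
    ∑ ν (λ i → (x i - y i) * G i)
      ≡⟨ ∑-cong ν (λ i _ → cong (_*_ (x i - y i)) (expands E i)) ⟩
    ∑ ν (λ i → (x i - y i) * ∑ (suc k) (λ h → α h * B h i))
      ≡⟨ ∑-*-∑ ν (suc k) (λ i → x i - y i) α B ⟩
    ∑ (suc k) (λ h → α h * ∑ ν (λ i → B h i * (x i - y i)))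
      ≡⟨ ∑-cong (suc k) (λ h h<1+k → cong (_*_ (α h)) (lhs≡∑-supported supported (≤-pred h<1+k))) ⟨
    ∑ (suc k) (λ h → α h * lhs ν d k h y x)
      ≡⟨ ∑-single (suc k) k (n<1+n k) (λ h h<1+k h≢k →
           trans (cong (_*_ (α h)) (lhs-h≡0 h (≤∧≢⇒< (≤-pred h<1+k) h≢k))) (*-zeroʳ (α h))) ⟩
    α k * lhs ν d k k y x
      ≡⟨ cong (_*_ (α k)) lhs-k≡1 ⟩
    α k * 1ℚ
      ≡⟨ *-identityʳ (α k) ⟩
    α k
      ∎
    where
    open ≡-Reasoning
    α = coeff E

  basic-solution-formula : ∀ {y x} → IsBasicSolution ν d k Y X y x →
    ∀ {j} → j ∈ Y ⊎ j ∈ X → x j - y j ≡ coef ν Y X j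
  basic-solution-formula {y} {x} solution@(supported , _) {j} j∈base =
    *-cancelʳ-≡ (z j) (coef ν Y X j) (F j) F[j]≢0 (begin
      z j * F j              ≡⟨ ∑-single ν j j<ν off-j ⟨
      ∑ ν (λ i → z i * F i)  ≡⟨ pairing-with-expansion solution E ⟩
      coeff E k              ≡⟨ leading-coeff E ⟩
      F (k ℕ.+ (ν ∸ k))      ≡⟨ cong F k+[ν∸k]≡ν ⟩
      ℕ→ℚ (ν C ν) * P ν      ≡⟨ cong (λ c → ℕ→ℚ c * P ν) (nCn≡1 ν) ⟩
      1ℚ * P ν               ≡⟨ *-identityˡ (P ν) ⟩
      P ν                    ≡⟨ coef*binomial*rootPoly ν Y X (<⇒≤ j<ν) ⟨
      coef ν Y X j * F j     ∎)
    where
    open ≡-Reasoning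
    j<ν = base<ν j∈base
    k+[ν∸k]≡ν = m+[n∸m]≡n (<⇒≤ k<ν)
    rest = others ν Y X j
    P = rootPoly rest
    F : ℕ → ℚ
    F i = ℕ→ℚ (ν C i) * P i
    E = binomial*rootPoly-expansion (ν ∸ k) k rest k+[ν∸k]≡ν (|others|≤k j∈base)
    z : ℕ → ℚ
    z i = x i - y i
    F[j]≢0 : F j ≢ 0ℚ
    F[j]≢0 = *-≢0 (ℕ→ℚ[nCk]≢0 (<⇒≤ j<ν)) (rootPoly-≢0 (others≢j ν Y X j))
    on-base : ∀ {i} → i < ν → i ≢ j → i ∈ Y ⊎ i ∈ X → z i * F i ≡ 0ℚ
    on-base {i} i<ν i≢j i∈base = begin
      z i * (ℕ→ℚ (ν C i) * P i)
        ≡⟨ cong (λ p → z i * (ℕ→ℚ (ν C i) * p)) (rootPoly-root (∈-others⁺ i<ν i∈base i≢j)) ⟩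
      z i * (ℕ→ℚ (ν C i) * 0ℚ)
        ≡⟨ cong (_*_ (z i)) (*-zeroʳ (ℕ→ℚ (ν C i))) ⟩
      z i * 0ℚ
        ≡⟨ *-zeroʳ (z i) ⟩
      0ℚ
        ∎
    off-j : ∀ i → i < ν → i ≢ j → z i * F i ≡ 0ℚ
    off-j i i<ν i≢j with i ∈? Y | i ∈? X
    ... | yes i∈Y | _       = on-base i<ν i≢j (inj₁ i∈Y)
    ... | no  _   | yes i∈X = on-base i<ν i≢j (inj₂ i∈X)
    ... | no  i∉Y | no  i∉X =
      trans (cong (_* F i) (cong₂ _-_ (proj₂ supported i i∉X) (proj₁ supported i i∉Y))) (*-zeroˡ (F i))

proposition6 : (k d ν : ℕ) → 1 ≤ k → k ≤ d → d < ν
    → (Y X : List ℕ) → IsBase ν d k Y X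
    → (y x : ℕ → ℚ) → IsBasicSolution ν d k Y X y x
    → (∀ i → i ∈ Y → y i ≡ - coef ν Y X i) × (∀ i → i ∈ X → x i ≡ coef ν Y X i)
proposition6 k d ν _ k≤d d<ν Y X base y x solution@((y-supported , x-supported) , _) = y-formula , x-formula
  where
  open ≡-Reasoning
  x-y≡coef : ∀ {i} → i ∈ Y ⊎ i ∈ X → x i - y i ≡ coef ν Y X i
  x-y≡coef = basic-solution-formula k≤d d<ν base solution
  y-formula : ∀ i → i ∈ Y → y i ≡ - coef ν Y X i
  y-formula i i∈Y = begin
    y i              ≡⟨ neg-involutive (y i) ⟨
    - (- y i)        ≡⟨ cong -_ (+-identityˡ (- y i)) ⟨
    - (0ℚ - y i)     ≡⟨ cong (λ t → - (t - y i)) (x-supported i (Y∩X≡∅ k≤d d<ν base i∈Y)) ⟨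
    - (x i - y i)    ≡⟨ cong -_ (x-y≡coef (inj₁ i∈Y)) ⟩
    - coef ν Y X i   ∎
  x-formula : ∀ i → i ∈ X → x i ≡ coef ν Y X i
  x-formula i i∈X = begin
    x i              ≡⟨ +-identityʳ (x i) ⟨
    x i - 0ℚ         ≡⟨ cong (_-_ (x i)) (y-supported i (λ i∈Y → Y∩X≡∅ k≤d d<ν base i∈Y i∈X)) ⟨
    x i - y i        ≡⟨ x-y≡coef (inj₂ i∈X) ⟩
    coef ν Y X i     ∎
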